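{- Let $k\ge1$ and let $G$ be a circular $k$-trapezoid graph with $n$ vertices. Then $\mathrm{boolw}(G)\le 2k\log_2 n$.
   Context: A circular $k$-trapezoid is given by $k$ arcs (intervals), one on each of $k$ fixed concentric circles. A graph is a circular $k$-trapezoid graph if it is the intersection graph of a family of circular $k$-trapezoids (one per vertex, adjacent iff they intersect). For $A\subseteq V(G)$ write $\overline{A}=V(G)\setminus A$. A decomposition tree of $G$ is a pair $(T,\delta)$ where $T$ is a tree whose internal nodes have degree three and which has $|V(G)|$ leaves, and $\delta$ is a bijection between $V(G)$ and the leaves of $T$; each edge of $T$ defines a cut $\{A,\overline{A}\}$ given by the leaves of the two components of $T$ minus that edge. Define $\mathrm{cut\text{ - }bool}(A)=\log_2|\{S\subseteq\overline{A} : \exists X\subseteq A,\ S=\overline{A}\cap\bigcup_{x\in X}N(x)\}|$. The boolean-width of $(T,\delta)$ is the maximum of $\mathrm{cut\text{ - }bool}(A)$ over cuts given by edges of $T$, and $\mathrm{boolw}(G)$ is the minimum over all decomposition trees of $G$.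
   Formalization: The arcs of each circular $k$-trapezoid have rational endpoints. -}

module Defs where

open import Data.Nat using (ℕ; zero; suc; _≤_)
open import Data.Integer using (ℤ)
open import Data.Rational using (ℚ; _/_; _+_; _<_; ½; 1ℚ)
import Data.Rational as ℚ
open import Data.Bool using (Bool; true; false; _∧_)
import Data.Bool as Bool
open import Data.Fin using (Fin; toℕ)
open import Data.Fin.Subset using (Subset; ⁅_⁆; _∪_; _∩_; ∁)
open import Data.Vec using (Vec; []; _∷_; lookup; tabulate)
open import Data.Vec.Properties using (≡-dec)
open import Data.List using (List; []; _∷_; _++_; map; length; deduplicate; allFin)
open import Data.Bool.ListAction using (any)
open import Data.List.Membership.Propositional using (_∈_)
open import Data.List.Relation.Unary.Unique.Propositional using (Unique)
open import Data.Product using (Σ; _×_; ∃-syntax)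
open import Relation.Nullary using (¬_)
open import Relation.Binary.PropositionalEquality using (_≡_; _≢_)
open import Function.Bundles using (_⇔_)

-- Graphs: a finite simple graph on vertex set Fin n, given by a
-- Boolean adjacency function E (irreflexivity/symmetry are imposed
-- where the graph is defined, see IsCircularTrapezoidGraph).

Graph : ℕ → Set
Graph n = Fin n → Fin n → Bool

-- The k concentric circles are indexed by Fin k (consecutive circles
-- have consecutive indices); each circle has circumference 1.
-- An arc on circle i is given in lifted (universal cover) coordinates
-- by [l i , r i] with l i ≤ r i < l i + 1 (a proper arc, not the whole
-- circle).  The trapezoid is the region bounded by the k arcs and the
-- two chains of side curves joining l i to l (i+1) and r i to r (i+1)
-- on consecutive circles; the lifts are chosen so that each side curve
-- turns by less than half a turn (the short way, as a straight segment
-- between consecutive circles does).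

record CircTrap (k : ℕ) : Set where
  field
    l r      : Fin k → ℚ
    l≤r      : ∀ i → l i ℚ.≤ r i
    r<l+1    : ∀ i → r i < l i + 1ℚ
    l-short  : ∀ i j → toℕ j ≡ suc (toℕ i) → (l j < l i + ½) × (l i < l j + ½)
    r-short  : ∀ i j → toℕ j ≡ suc (toℕ i) → (r j < r i + ½) × (r i < r j + ½)
open CircTrap public

ℤ→ℚ : ℤ → ℚ
ℤ→ℚ m = m / 1

-- Two (closed) circular k-trapezoids intersect iff for some integer
-- rotation m of the lift of V, the lifted (linear) k-trapezoids U and
-- V + m intersect, i.e. neither lies strictly to the left of the other
-- on every circle.
Intersect : ∀ {k} → CircTrap k → CircTrap k → Set
Intersect {k} U V = ∃[ m ]
  ( ¬ (∀ (i : Fin k) → r U i < l V i + ℤ→ℚ m)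
  × ¬ (∀ (i : Fin k) → r V i + ℤ→ℚ m < l U i) )

IsCircularTrapezoidGraph : (k : ℕ) {n : ℕ} → Graph n → Set
IsCircularTrapezoidGraph k {n} E =
  (∀ v → E v v ≡ false) ×
  Σ (Fin n → CircTrap k) λ T →
    ∀ u v → u ≢ v → (E u v ≡ true ⇔ Intersect (T u) (T v))

allSubsets : (n : ℕ) → List (Subset n)
allSubsets zero    = [] ∷ []
allSubsets (suc n) = map (true ∷_) (allSubsets n) ++ map (false ∷_) (allSubsets n)

nbhd : ∀ {n} → Graph n → Subset n → Subset n
nbhd {n} E X = tabulate λ v → any (λ x → lookup X x ∧ E x v) (allFin n)

-- number of distinct sets  (V∖A) ∩ N(X)  for X ⊆ A, i.e. 2^cut-bool(A)
cutBoolCount : ∀ {n} → Graph n → Subset n → ℕ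
cutBoolCount {n} E A =
  length (deduplicate (≡-dec Bool._≟_)
    (map (λ X → ∁ A ∩ nbhd E (X ∩ A)) (allSubsets n)))

-- Decomposition trees, represented as rooted full binary trees with
-- leaves labelled by vertices (suppressing the degree-2 root gives the
-- unrooted cubic tree; every edge of the latter corresponds to the
-- edge above some non-root node).
data BTree (n : ℕ) : Set where
  leaf : Fin n → BTree n
  node : BTree n → BTree n → BTree n

leaves : ∀ {n} → BTree n → List (Fin n)
leaves (leaf v)   = v ∷ []
leaves (node s t) = leaves s ++ leaves t

leafSet : ∀ {n} → BTree n → Subset n
leafSet (leaf v)   = ⁅ v ⁆
leafSet (node s t) = leafSet s ∪ leafSet t

IsDecompositionTree : ∀ {n} → BTree n → Set
IsDecompositionTree {n} t = Unique (leaves t) × (∀ (v : Fin n) → v ∈ leaves t)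

data Subtree {n} (s : BTree n) : BTree n → Set where
  here  : Subtree s s
  left  : ∀ {a b} → Subtree s a → Subtree s (node a b)
  right : ∀ {a b} → Subtree s b → Subtree s (node a b)

data ProperSubtree {n} (s : BTree n) : BTree n → Set where
  left  : ∀ {a b} → Subtree s a → ProperSubtree s (node a b)
  right : ∀ {a b} → Subtree s b → ProperSubtree s (node a b)

-- boolw(G) ≤ log₂ b : some decomposition tree has, for every cut
-- {A, V∖A} given by one of its edges, 2^cut-bool ≤ b (both sides).
BoolwLog2AtMost : ∀ {n} → Graph n → ℕ → Set
BoolwLog2AtMost {n} E b =
  Σ (BTree n) λ t → IsDecompositionTree t ×
    (∀ s → ProperSubtree s t →
       (cutBoolCount E (leafSet s) ≤ b) × (cutBoolCount E (∁ (leafSet s)) ≤ b))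

-- Rotate every trapezoid by an integer so that its arc on circle 0 starts in [0, 1), and call
-- that starting point the key of the vertex.  If key x ≤ key v, only the relative rotations
-- 0 and -1 can make the trapezoids of x and v meet, so they meet iff on some circle the arc
-- of v starts before the arc of x ends, or on some circle the arc of x, turned once, starts
-- before the arc of v ends.  Both conditions improve when x is replaced by the vertex with the
-- largest right end, respectively the smallest left end, on that circle.  So for a cut that
-- separates small keys from large keys, the neighbours across the cut of any X ⊆ A are already
-- the neighbours of these 2k extremal members of X, and the cut has at most n^(2k) distinct
-- neighbourhood traces.  Ordering the vertices by key, the caterpillar decomposition has only
-- such cuts besides single vertices, whose cuts are small for trivial reasons.

module Submission where

open import Defs
open import Data.Nat as ℕ using (ℕ; zero; suc; _≤_; _*_; _^_; z≤n; s≤s)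
import Data.Nat.Properties as ℕP
open import Data.Integer as ℤ using (ℤ; +_; -[1+_])
import Data.Integer.Properties as ℤP
import Data.Integer.DivMod as ℤD
open import Data.Integer.Solver using (module +-*-Solver)
open import Data.Rational as ℚ using (ℚ; ↥_; ↧_; _+_; _-_; -_; 1ℚ; 0ℚ; floor)
import Data.Rational.Properties as ℚP
open import Data.Rational.Solver renaming (module +-*-Solver to ℚ-Solver)
import Data.Rational.Unnormalised as ℚᵘ
import Data.Rational.Unnormalised.Properties as ℚᵘP
open import Data.Bool using (true)
import Data.Bool as Bool
open import Data.Bool.Properties using (T-≡; T-∧)
open import Data.Fin using (Fin; zero; suc)
import Data.Fin.Properties as FinP
open import Data.Fin.Subset using (Subset; _∈_; _∉_; _⊆_; ⁅_⁆; _∪_; _∩_; ∁) renaming (⊥ to ∅)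
open import Data.Fin.Subset.Properties
  using (_∈?_; ∉⊥; x∈⁅x⁆; x∈⁅y⁆⇒x≡y; x∈p∪q⁺; x∈p∪q⁻; x∈p∩q⁺; x∈p∩q⁻; x∈p⇒x∉∁p; x∈∁p⇒x∉p; x∉∁p⇒x∈p; ⊆-antisym)
open import Data.Vec as Vec using (Vec; tabulate)
open import Data.Vec.Properties using (≡-dec; lookup∘tabulate; []=⇒lookup; lookup⇒[]=)
open import Data.Vec.Relation.Unary.Any using () renaming (here to hereᵥ; there to thereᵥ)
import Data.Vec.Relation.Unary.All as VecAll
open import Data.Vec.Relation.Unary.All.Properties using (tabulate⁺) renaming (++⁺ to All-++⁺)
open import Data.Vec.Membership.Propositional using () renaming (_∈_ to _∈ᵥ_)
open import Data.Vec.Membership.Propositional.Properties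
  using (∈-tabulate⁺) renaming (∈-++⁺ˡ to ∈ᵥ-++⁺ˡ; ∈-++⁺ʳ to ∈ᵥ-++⁺ʳ)
open import Data.List using (List; []; _∷_; _++_; [_]; length; map; filter; deduplicate; cartesianProductWith; allFin)
open import Data.List.Properties using (length-++; length-map; length-tabulate)
open import Data.List.Relation.Unary.Any using (here; there; satisfied)
open import Data.List.Relation.Unary.Any.Properties using (any⁺; any⁻)
import Data.List.Relation.Unary.All as All
open import Data.List.Relation.Unary.AllPairs as AllPairs using (AllPairs; _∷_)
open import Data.List.Relation.Unary.Unique.Propositional using (Unique)
open import Data.List.Relation.Unary.Unique.Propositional.Properties using (allFin⁺)
import Data.List.Relation.Unary.Unique.DecPropositional.Properties as UniqueDec
open import Data.List.Membership.Propositional using (lose) renaming (_∈_ to _∈ₗ_)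
open import Data.List.Membership.Propositional.Properties
  using (∈-allFin; ∈-map⁺; ∈-map⁻; ∈-deduplicate⁻; ∈-filter⁺; ∈-filter⁻; ∈-∃++; ∈-++⁻; ∈-++⁺ˡ; ∈-++⁺ʳ; ∈-cartesianProductWith⁺)
open import Data.List.Relation.Binary.Subset.Propositional using () renaming (_⊆_ to _⊆ₗ_)
open import Data.List.Relation.Binary.Permutation.Propositional using (↭-sym; ↭⇒↭ₛ)
open import Data.List.Relation.Binary.Permutation.Propositional.Properties using (∈-resp-↭)
import Data.List.Relation.Binary.Permutation.Setoid.Properties as PermutationSetoid
open import Data.List.Relation.Unary.Sorted.TotalOrder.Properties using (Sorted⇒AllPairs)
import Data.List.Sort as Sort
open import Relation.Binary.Bundles using (DecTotalOrder)
open import Data.List.Extrema (DecTotalOrder.totalOrder ℚP.≤-decTotalOrder)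
  using (argmax; argmin; argmax-sel; argmin-sel; f[⊥]≤f[argmax]; f[xs]≤f[argmax]; f[argmin]≤f[⊤]; f[argmin]≤f[xs])
open import Data.Product using (_×_; _,_; proj₁; proj₂; ∃-syntax)
open import Data.Sum using (_⊎_; inj₁; inj₂)
open import Data.Empty using (⊥-elim)
open import Function.Base using (case_of_)
open import Function.Bundles using (_⇔_; mk⇔; Equivalence)
import Function.Properties.Equivalence as ⇔
open import Relation.Nullary using (¬_; yes; no)
open import Relation.Nullary.Decidable using (_×-dec_)
import Relation.Binary.Construct.On as On
open import Relation.Binary.Definitions using (DecidableEquality)
open import Relation.Binary.PropositionalEquality
  using (_≡_; _≢_; refl; sym; trans; cong; cong₂; subst; subst₂; setoid; module ≡-Reasoning)

-- ℤ→ℚ a = a / 1 is definitionally ℚ.fromℚᵘ (ℤ→ℚᵘ a), so facts about ℤ→ℚ are transported from ℚᵘ.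
ℤ→ℚᵘ : ℤ → ℚᵘ.ℚᵘ
ℤ→ℚᵘ a = ℚᵘ.mkℚᵘ a 0

toℚᵘ-ℤ→ℚ : ∀ a → ℚᵘ._≃_ (ℚ.toℚᵘ (ℤ→ℚ a)) (ℤ→ℚᵘ a)
toℚᵘ-ℤ→ℚ a = ℚP.toℚᵘ-fromℚᵘ (ℤ→ℚᵘ a)

ℤ→ℚᵘ-+ : ∀ a b → ℚᵘ._≃_ (ℤ→ℚᵘ (a ℤ.+ b)) (ℤ→ℚᵘ a ℚᵘ.+ ℤ→ℚᵘ b)
ℤ→ℚᵘ-+ a b = ℚᵘ.*≡* (cong (ℤ._* + 1) (sym (cong₂ ℤ._+_ (ℤP.*-identityʳ a) (ℤP.*-identityʳ b))))

ℤ→ℚ-+ : ∀ a b → ℤ→ℚ (a ℤ.+ b) ≡ ℤ→ℚ a + ℤ→ℚ b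
ℤ→ℚ-+ a b = ℚP.toℚᵘ-injective (begin
  ℚ.toℚᵘ (ℤ→ℚ (a ℤ.+ b))              ≈⟨ toℚᵘ-ℤ→ℚ (a ℤ.+ b) ⟩
  ℤ→ℚᵘ (a ℤ.+ b)                      ≈⟨ ℤ→ℚᵘ-+ a b ⟩
  ℤ→ℚᵘ a ℚᵘ.+ ℤ→ℚᵘ b                  ≈⟨ ℚᵘP.+-cong (toℚᵘ-ℤ→ℚ a) (toℚᵘ-ℤ→ℚ b) ⟨
  ℚ.toℚᵘ (ℤ→ℚ a) ℚᵘ.+ ℚ.toℚᵘ (ℤ→ℚ b)  ≈⟨ ℚP.toℚᵘ-homo-+ (ℤ→ℚ a) (ℤ→ℚ b) ⟨
  ℚ.toℚᵘ (ℤ→ℚ a + ℤ→ℚ b)              ∎)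
  where open ℚᵘP.≃-Reasoning

ℤ→ℚ-neg : ∀ a → ℤ→ℚ (ℤ.- a) ≡ - ℤ→ℚ a
ℤ→ℚ-neg a = ℚP.toℚᵘ-injective (begin
  ℚ.toℚᵘ (ℤ→ℚ (ℤ.- a))  ≈⟨ toℚᵘ-ℤ→ℚ (ℤ.- a) ⟩
  ℤ→ℚᵘ (ℤ.- a)          ≈⟨ ℚᵘP.-‿cong (toℚᵘ-ℤ→ℚ a) ⟨
  ℚᵘ.- ℚ.toℚᵘ (ℤ→ℚ a)   ≈⟨ ℚP.toℚᵘ-homo‿- (ℤ→ℚ a) ⟨
  ℚ.toℚᵘ (- ℤ→ℚ a)      ∎)
  where open ℚᵘP.≃-Reasoning

ℤ→ℚ-sub : ∀ a b → ℤ→ℚ (a ℤ.- b) ≡ ℤ→ℚ a - ℤ→ℚ b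
ℤ→ℚ-sub a b = trans (ℤ→ℚ-+ a (ℤ.- b)) (cong (λ s → ℤ→ℚ a + s) (ℤ→ℚ-neg b))

ℤ→ℚ-mono-≤ : ∀ {a b} → a ℤ.≤ b → ℤ→ℚ a ℚ.≤ ℤ→ℚ b
ℤ→ℚ-mono-≤ {a} {b} a≤b = ℚP.toℚᵘ-cancel-≤ (begin
  ℚ.toℚᵘ (ℤ→ℚ a)  ≃⟨ toℚᵘ-ℤ→ℚ a ⟩
  ℤ→ℚᵘ a          ≤⟨ ℚᵘ.*≤* (ℤP.*-monoʳ-≤-nonNeg (+ 1) a≤b) ⟩
  ℤ→ℚᵘ b          ≃⟨ toℚᵘ-ℤ→ℚ b ⟨
  ℚ.toℚᵘ (ℤ→ℚ b)  ∎)
  where open ℚᵘP.≤-Reasoning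

[n/d]*d≤n : ∀ n d .{{_ : ℕ.NonZero d}} → (n ℤD./ + d) ℤ.* + d ℤ.≤ n
[n/d]*d≤n n d = begin
  (n ℤD./ + d) ℤ.* + d                     ≤⟨ ℤP.i≤j+i ((n ℤD./ + d) ℤ.* + d) (+ (n ℤD.% + d)) ⟩
  + (n ℤD.% + d) ℤ.+ (n ℤD./ + d) ℤ.* + d  ≡⟨ ℤD.a≡a%n+[a/n]*n n (+ d) ⟨
  n                                        ∎
  where open ℤP.≤-Reasoning

n<[n/d+1]*d : ∀ n d .{{_ : ℕ.NonZero d}} → n ℤ.< (n ℤD./ + d ℤ.+ + 1) ℤ.* + d
n<[n/d+1]*d n d = begin-strict
  n                                        ≡⟨ ℤD.a≡a%n+[a/n]*n n (+ d) ⟩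
  + (n ℤD.% + d) ℤ.+ (n ℤD./ + d) ℤ.* + d  <⟨ ℤP.+-monoˡ-< ((n ℤD./ + d) ℤ.* + d) (ℤ.+<+ (ℤD.n%d<d n (+ d))) ⟩
  + d ℤ.+ (n ℤD./ + d) ℤ.* + d             ≡⟨ solve 2 (λ d f → d :+ f :* d := (f :+ con (+ 1)) :* d)
                                                      refl (+ d) (n ℤD./ + d) ⟩
  (n ℤD./ + d ℤ.+ + 1) ℤ.* + d             ∎
  where open ℤP.≤-Reasoning; open +-*-Solver

ℤ→ℚ[⌊p⌋]≤p : ∀ p → ℤ→ℚ (floor p) ℚ.≤ p
ℤ→ℚ[⌊p⌋]≤p p@record{} = ℚP.toℚᵘ-cancel-≤ (begin
  ℚ.toℚᵘ (ℤ→ℚ (floor p))  ≃⟨ toℚᵘ-ℤ→ℚ (floor p) ⟩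
  ℤ→ℚᵘ (floor p)          ≤⟨ ℚᵘ.*≤* (subst (floor p ℤ.* ↧ p ℤ.≤_) (sym (ℤP.*-identityʳ (↥ p)))
                                        ([n/d]*d≤n (↥ p) (ℚ.↧ₙ p))) ⟩
  ℚ.toℚᵘ p                ∎)
  where open ℚᵘP.≤-Reasoning

p<ℤ→ℚ[⌊p⌋]+1 : ∀ p → p ℚ.< ℤ→ℚ (floor p) + 1ℚ
p<ℤ→ℚ[⌊p⌋]+1 p@record{} = ℚP.toℚᵘ-cancel-< (begin-strict
  ℚ.toℚᵘ p                        <⟨ ℚᵘ.*<* (subst (ℤ._< (floor p ℤ.+ + 1) ℤ.* ↧ p) (sym (ℤP.*-identityʳ (↥ p)))
                                                (n<[n/d+1]*d (↥ p) (ℚ.↧ₙ p))) ⟩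
  ℤ→ℚᵘ (floor p ℤ.+ + 1)          ≃⟨ toℚᵘ-ℤ→ℚ (floor p ℤ.+ + 1) ⟨
  ℚ.toℚᵘ (ℤ→ℚ (floor p ℤ.+ + 1))  ≡⟨ cong ℚ.toℚᵘ (ℤ→ℚ-+ (floor p) (+ 1)) ⟩
  ℚ.toℚᵘ (ℤ→ℚ (floor p) + 1ℚ)     ∎)
  where open ℚᵘP.≤-Reasoning

-- Overlapping lifts of families of arcs

¬∀<⇔∃≥ : ∀ {k} (a b : Fin k → ℚ) → (¬ (∀ i → a i ℚ.< b i)) ⇔ (∃[ i ] b i ℚ.≤ a i)
¬∀<⇔∃≥ {k} a b = mk⇔ to from
  where
  to : ¬ (∀ i → a i ℚ.< b i) → ∃[ i ] b i ℚ.≤ a i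
  to ¬a<b with i , a≮b ← FinP.¬∀⟶∃¬ k _ (λ i → a i ℚP.<? b i) ¬a<b = i , ℚP.≮⇒≥ a≮b
  from : ∃[ i ] b i ℚ.≤ a i → ¬ (∀ i → a i ℚ.< b i)
  from (i , b≤a) a<b = ℚP.<-irrefl refl (ℚP.<-≤-trans (a<b i) b≤a)

p≤p+q : ∀ p {q} → 0ℚ ℚ.≤ q → p ℚ.≤ p + q
p≤p+q p {q} 0≤q = subst (ℚ._≤ p + q) (ℚP.+-identityʳ p) (ℚP.+-monoʳ-≤ p 0≤q)

p+r≤q⇔p≤q-r : ∀ p r q → (p + r ℚ.≤ q) ⇔ (p ℚ.≤ q - r)
p+r≤q⇔p≤q-r p r q = mk⇔
  (λ p+r≤q → subst (ℚ._≤ q - r) (solve 2 (λ p r → (p :+ r) :- r := p) refl p r) (ℚP.+-monoˡ-≤ (- r) p+r≤q))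
  (λ p≤q-r → subst (p + r ℚ.≤_) (solve 2 (λ q r → (q :- r) :+ r := q) refl q r) (ℚP.+-monoˡ-≤ r p≤q-r))
  where open ℚ-Solver

p≤q⇔p-a≤q-a : ∀ p q a → (p ℚ.≤ q) ⇔ (p - a ℚ.≤ q - a)
p≤q⇔p-a≤q-a p q a = mk⇔ (ℚP.+-monoˡ-≤ (- a))
  (λ p-a≤q-a → subst₂ ℚ._≤_ (cancel p) (cancel q) (ℚP.+-monoˡ-≤ a p-a≤q-a))
  where
  open ℚ-Solver
  cancel : ∀ x → (x - a) + a ≡ x
  cancel x = solve 2 (λ x a → (x :- a) :+ a := x) refl x a

module _ {k : ℕ} (lU rU lV rV : Fin k → ℚ) where

  Overlap : ℚ → Set
  Overlap t = (∃[ i ] lV i + t ℚ.≤ rU i) × (∃[ j ] lU j ℚ.≤ rV j + t)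

  Crossing : Set
  Crossing = (∃[ i ] lV i ℚ.≤ rU i) ⊎ (∃[ j ] lU j + 1ℚ ℚ.≤ rV j)

  overlap⇒crossing : ∀ m → Overlap (ℤ→ℚ m) → Crossing
  overlap⇒crossing (+ n) ((i , lV+m≤rU) , _) =
    inj₁ (i , ℚP.≤-trans (p≤p+q (lV i) (ℤ→ℚ-mono-≤ {+ 0} {+ n} (ℤ.+≤+ ℕ.z≤n))) lV+m≤rU)
  overlap⇒crossing -[1+ n ] (_ , (j , lU≤rV+m)) =
    inj₂ (j , Equivalence.from (p+r≤q⇔p≤q-r (lU j) 1ℚ (rV j))
      (ℚP.≤-trans lU≤rV+m (ℚP.+-monoʳ-≤ (rV j) (ℤ→ℚ-mono-≤ { -[1+ n ]} { -[1+ 0 ]} (ℤ.-≤- ℕ.z≤n)))))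

  crossing⇒overlap : ∀ o → 0ℚ ℚ.≤ lU o → lU o ℚ.≤ lV o → lV o ℚ.< 1ℚ → lU o ℚ.≤ rU o → lV o ℚ.≤ rV o →
                     Crossing → ∃[ m ] Overlap (ℤ→ℚ m)
  crossing⇒overlap o 0≤lU lU≤lV lV<1 lU≤rU lV≤rV (inj₁ (i , lV≤rU)) =
    + 0 , (i , ≤-+0 lV≤rU) , (o , ≤+0 (ℚP.≤-trans lU≤lV lV≤rV))
    where
    ≤-+0 : ∀ {p q} → p ℚ.≤ q → p + 0ℚ ℚ.≤ q
    ≤-+0 {p} = subst (ℚ._≤ _) (sym (ℚP.+-identityʳ p))
    ≤+0 : ∀ {p q} → p ℚ.≤ q → p ℚ.≤ q + 0ℚ
    ≤+0 {q = q} = subst (_ ℚ.≤_) (sym (ℚP.+-identityʳ q))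
  crossing⇒overlap o 0≤lU lU≤lV lV<1 lU≤rU lV≤rV (inj₂ (j , lU+1≤rV)) =
    -[1+ 0 ] ,
    (o , ℚP.<⇒≤ (ℚP.<-≤-trans (ℚP.+-monoˡ-< (- 1ℚ) lV<1) (ℚP.≤-trans 0≤lU lU≤rU))) ,
    (j , Equivalence.to (p+r≤q⇔p≤q-r (lU j) 1ℚ (rV j)) lU+1≤rV)

Overlap-sym : ∀ {k} (lU rU lV rV : Fin k → ℚ) t → Overlap lU rU lV rV t → Overlap lV rV lU rU (- t)
Overlap-sym lU rU lV rV t ((i , lV+t≤rU) , (j , lU≤rV+t)) =
  (j , Equivalence.from (p+r≤q⇔p≤q-r (lU j) (- t) (rV j))
         (subst (λ s → lU j ℚ.≤ rV j + s) (solve 1 (λ t → t := :- :- t) refl t) lU≤rV+t)) ,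
  (i , Equivalence.to (p+r≤q⇔p≤q-r (lV i) t (rU i)) lV+t≤rU)
  where open ℚ-Solver

Intersect⇔Overlap : ∀ {k} (U V : CircTrap k) →
  Intersect U V ⇔ (∃[ m ] Overlap (l U) (r U) (l V) (r V) (ℤ→ℚ m))
Intersect⇔Overlap U V = mk⇔
  (λ (m , ¬r<l , ¬r<l′) → m , Equivalence.to (¬∀<⇔∃≥ _ _) ¬r<l , Equivalence.to (¬∀<⇔∃≥ _ _) ¬r<l′)
  (λ (m , l≤r , l≤r′) → m , Equivalence.from (¬∀<⇔∃≥ _ _) l≤r , Equivalence.from (¬∀<⇔∃≥ _ _) l≤r′)

Intersect-sym : ∀ {k} (U V : CircTrap k) → Intersect U V → Intersect V U
Intersect-sym U V UV with m , ov ← Equivalence.to (Intersect⇔Overlap U V) UV =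
  Equivalence.from (Intersect⇔Overlap V U)
    (ℤ.- m , subst (Overlap (l V) (r V) (l U) (r U)) (sym (ℤ→ℚ-neg m)) (Overlap-sym _ _ _ _ _ ov))

Overlap-translate : ∀ {k} (lU rU lV rV : Fin k → ℚ) a b t →
  Overlap lU rU lV rV t ⇔
  Overlap (λ i → lU i - a) (λ i → rU i - a) (λ i → lV i - b) (λ i → rV i - b) (t + (b - a))
Overlap-translate lU rU lV rV a b t = mk⇔
  (λ ((i , p) , (j , q)) → (i , subst (ℚ._≤ _) (sym (shift (lV i))) (to p)) ,
                           (j , subst (_ ℚ.≤_) (sym (shift (rV j))) (to q)))
  (λ ((i , p) , (j , q)) → (i , from (subst (ℚ._≤ _) (shift (lV i)) p)) ,
                           (j , from (subst (_ ℚ.≤_) (shift (rV j)) q)))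
  where
  open ℚ-Solver
  open module ≤⇔ {p q} = Equivalence (p≤q⇔p-a≤q-a p q a)
  shift : ∀ x → (x - b) + (t + (b - a)) ≡ (x + t) - a
  shift x = solve 4 (λ x a b t → (x :- b) :+ (t :+ (b :- a)) := (x :+ t) :- a) refl x a b t

-- Normalised circular trapezoids

module _ {k : ℕ} where

  offset : CircTrap (suc k) → ℤ
  offset U = floor (l U zero)

  normL normR : CircTrap (suc k) → Fin (suc k) → ℚ
  normL U i = l U i - ℤ→ℚ (offset U)
  normR U i = r U i - ℤ→ℚ (offset U)

  0≤normL₀ : ∀ U → 0ℚ ℚ.≤ normL U zero
  0≤normL₀ U = subst (ℚ._≤ normL U zero) (ℚP.+-inverseʳ (ℤ→ℚ (offset U)))
    (ℚP.+-monoˡ-≤ (- ℤ→ℚ (offset U)) (ℤ→ℚ[⌊p⌋]≤p (l U zero)))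

  normL₀<1 : ∀ U → normL U zero ℚ.< 1ℚ
  normL₀<1 U = subst (normL U zero ℚ.<_) (solve 2 (λ c o → (c :+ o) :- c := o) refl (ℤ→ℚ (offset U)) 1ℚ)
                     (ℚP.+-monoˡ-< (- ℤ→ℚ (offset U)) (p<ℤ→ℚ[⌊p⌋]+1 (l U zero)))
    where open ℚ-Solver

  normL≤normR : ∀ U i → normL U i ℚ.≤ normR U i
  normL≤normR U i = ℚP.+-monoˡ-≤ (- ℤ→ℚ (offset U)) (l≤r U i)

  Intersect⇔normOverlap : ∀ U V →
    Intersect U V ⇔ (∃[ m ] Overlap (normL U) (normR U) (normL V) (normR V) (ℤ→ℚ m))
  Intersect⇔normOverlap U V = mk⇔
    (λ UV → let m , ov = Equivalence.to (Intersect⇔Overlap U V) UV in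
      m ℤ.+ d , subst normOverlap (sym (shift m)) (Equivalence.to (translate (ℤ→ℚ m)) ov))
    (λ (m , ov) → Equivalence.from (Intersect⇔Overlap U V)
      (m ℤ.- d , Equivalence.from (translate (ℤ→ℚ (m ℤ.- d))) (subst normOverlap (unshift m) ov)))
    where
    a b : ℚ
    a = ℤ→ℚ (offset U)
    b = ℤ→ℚ (offset V)
    d : ℤ
    d = offset V ℤ.- offset U
    normOverlap : ℚ → Set
    normOverlap = Overlap (normL U) (normR U) (normL V) (normR V)
    translate : ∀ t → Overlap (l U) (r U) (l V) (r V) t ⇔ normOverlap (t + (b - a))
    translate = Overlap-translate (l U) (r U) (l V) (r V) a b
    shift : ∀ m → ℤ→ℚ (m ℤ.+ d) ≡ ℤ→ℚ m + (b - a)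
    shift m = trans (ℤ→ℚ-+ m d) (cong (λ s → ℤ→ℚ m + s) (ℤ→ℚ-sub (offset V) (offset U)))
    unshift : ∀ m → ℤ→ℚ m ≡ ℤ→ℚ (m ℤ.- d) + (b - a)
    unshift m = trans (cong ℤ→ℚ (solve 2 (λ m d → m := (m :- d) :+ d) refl m d)) (shift (m ℤ.- d))
      where open +-*-Solver

  Intersect⇔Crossing : ∀ U V → normL U zero ℚ.≤ normL V zero →
    Intersect U V ⇔ Crossing (normL U) (normR U) (normL V) (normR V)
  Intersect⇔Crossing U V U≤V = mk⇔
    (λ UV → let m , ov = Equivalence.to (Intersect⇔normOverlap U V) UV in overlap⇒crossing _ _ _ _ m ov)
    (λ c → Equivalence.from (Intersect⇔normOverlap U V)
      (crossing⇒overlap _ _ _ _ zero (0≤normL₀ U) U≤V (normL₀<1 V) (normL≤normR U zero) (normL≤normR V zero) c))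

module _ {a} {A : Set a} where

  Unique-⊆⇒length≤ : {xs ys : List A} → Unique xs → xs ⊆ₗ ys → length xs ≤ length ys
  Unique-⊆⇒length≤ {[]} _ _ = z≤n
  Unique-⊆⇒length≤ {x ∷ xs} (x∉xs ∷ !xs) x∷xs⊆ys
    with ys₁ , ys₂ , refl ← ∈-∃++ (x∷xs⊆ys (here refl)) = begin
      suc (length xs)                  ≤⟨ s≤s (Unique-⊆⇒length≤ !xs xs⊆ys₁++ys₂) ⟩
      suc (length (ys₁ ++ ys₂))        ≡⟨ cong suc (length-++ ys₁) ⟩
      suc (length ys₁ ℕ.+ length ys₂)  ≡⟨ ℕP.+-suc (length ys₁) (length ys₂) ⟨
      length ys₁ ℕ.+ suc (length ys₂)  ≡⟨ length-++ ys₁ ⟨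
      length (ys₁ ++ x ∷ ys₂)          ∎
    where
    open ℕP.≤-Reasoning
    xs⊆ys₁++ys₂ : xs ⊆ₗ ys₁ ++ ys₂
    xs⊆ys₁++ys₂ y∈xs with ∈-++⁻ ys₁ (x∷xs⊆ys (there y∈xs))
    ... | inj₁ y∈ys₁         = ∈-++⁺ˡ y∈ys₁
    ... | inj₂ (here refl)   = ⊥-elim (All.lookup x∉xs y∈xs refl)
    ... | inj₂ (there y∈ys₂) = ∈-++⁺ʳ ys₁ y∈ys₂

  vectorsOver : List A → (m : ℕ) → List (Vec A m)
  vectorsOver xs zero    = [ Vec.[] ]
  vectorsOver xs (suc m) = cartesianProductWith Vec._∷_ xs (vectorsOver xs m)

  length-cartesianProductWith : ∀ {B C : Set a} (f : A → B → C) xs ys →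
    length (cartesianProductWith f xs ys) ≡ length xs * length ys
  length-cartesianProductWith f []       ys = refl
  length-cartesianProductWith f (x ∷ xs) ys = begin
    length (map (f x) ys ++ cartesianProductWith f xs ys)  ≡⟨ length-++ (map (f x) ys) ⟩
    length (map (f x) ys) ℕ.+ length (cartesianProductWith f xs ys)
      ≡⟨ cong₂ ℕ._+_ (length-map (f x) ys) (length-cartesianProductWith f xs ys) ⟩
    length ys ℕ.+ length xs * length ys  ∎
    where open ≡-Reasoning

  length-vectorsOver : ∀ xs m → length (vectorsOver xs m) ≡ length xs ^ m
  length-vectorsOver xs zero    = refl
  length-vectorsOver xs (suc m) = trans (length-cartesianProductWith Vec._∷_ xs (vectorsOver xs m))
    (cong (length xs *_) (length-vectorsOver xs m))

  ∈-vectorsOver : ∀ {xs m} (w : Vec A m) → (∀ x → x ∈ₗ xs) → w ∈ₗ vectorsOver xs m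
  ∈-vectorsOver Vec.[]      _   = here refl
  ∈-vectorsOver (x Vec.∷ w) all = ∈-cartesianProductWith⁺ Vec._∷_ (all x) (∈-vectorsOver w all)

vertexSet : ∀ {n m} → Vec (Fin n) m → Subset n
vertexSet Vec.[]      = ∅
vertexSet (y Vec.∷ w) = ⁅ y ⁆ ∪ vertexSet w

∈-vertexSet⁺ : ∀ {n m y} {w : Vec (Fin n) m} → y ∈ᵥ w → y ∈ vertexSet w
∈-vertexSet⁺ (hereᵥ refl) = x∈p∪q⁺ (inj₁ (x∈⁅x⁆ _))
∈-vertexSet⁺ (thereᵥ y∈w) = x∈p∪q⁺ (inj₂ (∈-vertexSet⁺ y∈w))

∈-vertexSet⁻ : ∀ {n m y} {w : Vec (Fin n) m} → y ∈ vertexSet w → y ∈ᵥ w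
∈-vertexSet⁻ {w = Vec.[]} y∈∅ = ⊥-elim (∉⊥ y∈∅)
∈-vertexSet⁻ {w = x Vec.∷ w} y∈x∪w with x∈p∪q⁻ ⁅ x ⁆ (vertexSet w) y∈x∪w
... | inj₁ y∈x = hereᵥ (x∈⁅y⁆⇒x≡y x y∈x)
... | inj₂ y∈w = thereᵥ (∈-vertexSet⁻ y∈w)

x∉∁⁅y⁆⇒x≡y : ∀ {n} {x} (y : Fin n) → x ∉ ∁ ⁅ y ⁆ → x ≡ y
x∉∁⁅y⁆⇒x≡y y x∉∁⁅y⁆ = x∈⁅y⁆⇒x≡y y (x∉∁p⇒x∈p x∉∁⁅y⁆)

∈∉⇒≢ : ∀ {n} {A : Subset n} {x v} → x ∈ A → v ∉ A → x ≢ v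
∈∉⇒≢ x∈A v∉A refl = v∉A x∈A

elements : ∀ {n} → Subset n → List (Fin n)
elements {n} S = filter (_∈? S) (allFin n)

∈-elements⁺ : ∀ {n} {S : Subset n} {x} → x ∈ S → x ∈ₗ elements S
∈-elements⁺ {S = S} x∈S = ∈-filter⁺ (_∈? S) (∈-allFin _) x∈S

∈-elements⁻ : ∀ {n} {S : Subset n} {x} → x ∈ₗ elements S → x ∈ S
∈-elements⁻ {n} {S} x∈ = proj₂ (∈-filter⁻ (_∈? S) {xs = allFin n} x∈)

module _ {n : ℕ} (E : Graph n) where

  ∈-nbhd⁻ : ∀ {X v} → v ∈ nbhd E X → ∃[ x ] x ∈ X × E x v ≡ true
  ∈-nbhd⁻ {X} {v} v∈N
    with x , Xx∧Exv ← satisfied (any⁻ _ (allFin n)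
           (Equivalence.from T-≡ (trans (sym (lookup∘tabulate _ v)) ([]=⇒lookup v∈N))))
    with Xx , Exv ← Equivalence.to T-∧ Xx∧Exv
    = x , lookup⇒[]= x X (Equivalence.to T-≡ Xx) , Equivalence.to T-≡ Exv

  ∈-nbhd⁺ : ∀ {X x v} → x ∈ X → E x v ≡ true → v ∈ nbhd E X
  ∈-nbhd⁺ {X} {x} {v} x∈X Exv = lookup⇒[]= v (nbhd E X) (trans (lookup∘tabulate _ v)
    (Equivalence.to T-≡ (any⁺ _ (lose (∈-allFin x)
      (Equivalence.from T-∧ (Equivalence.from T-≡ ([]=⇒lookup x∈X) , Equivalence.from T-≡ Exv))))))

  cutValue : Subset n → Subset n → Subset n
  cutValue A X = ∁ A ∩ nbhd E (X ∩ A)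

  Covers : Subset n → Subset n → Subset n → Set
  Covers A X S = ∀ {x v} → x ∈ X → x ∈ A → v ∉ A → E x v ≡ true → ∃[ y ] y ∈ S × y ∈ A × E y v ≡ true

  cutValue-⊆ : ∀ {A X S} → Covers A X S → cutValue A X ⊆ cutValue A S
  cutValue-⊆ {A} {X} {S} cover v∈val
    with v∈∁A , v∈N ← x∈p∩q⁻ (∁ A) _ v∈val
    with x , x∈X∩A , Exv ← ∈-nbhd⁻ v∈N
    with x∈X , x∈A ← x∈p∩q⁻ X A x∈X∩A
    with y , y∈S , y∈A , Eyv ← cover x∈X x∈A (x∈∁p⇒x∉p v∈∁A) Exv
    = x∈p∩q⁺ (v∈∁A , ∈-nbhd⁺ (x∈p∩q⁺ (y∈S , y∈A)) Eyv)

  cutValue-≡ : ∀ {A X S} → (∀ {y} → y ∈ S → y ∈ A → y ∈ X) → Covers A X S → cutValue A X ≡ cutValue A S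
  cutValue-≡ S∩A⊆X cover = ⊆-antisym (cutValue-⊆ cover)
    (cutValue-⊆ (λ y∈S y∈A _ Eyv → _ , S∩A⊆X y∈S y∈A , y∈A , Eyv))

  cutValue-vertexSet : ∀ {A X m} {w : Vec (Fin n) m} → VecAll.All (λ y → y ∈ A → y ∈ X) w →
    (∀ {x v} → x ∈ X → x ∈ A → v ∉ A → E x v ≡ true → ∃[ y ] y ∈ᵥ w × y ∈ A × E y v ≡ true) →
    cutValue A X ≡ cutValue A (vertexSet w)
  cutValue-vertexSet sound cover = cutValue-≡ (λ y∈w → VecAll.lookup sound (∈-vertexSet⁻ y∈w))
    (λ x∈X x∈A v∉A Exv → let y , y∈w , rest = cover x∈X x∈A v∉A Exv in y , ∈-vertexSet⁺ y∈w , rest)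

  Represented : Subset n → ℕ → Set
  Represented A m = ∀ X → ∃[ w ] cutValue A X ≡ cutValue A (vertexSet {m = m} w)

  cutBoolCount≤ : ∀ {A m} → Represented A m → cutBoolCount E A ≤ n ^ m
  cutBoolCount≤ {A} {m} rep = begin
    cutBoolCount E A                                 ≤⟨ Unique-⊆⇒length≤ (UniqueDec.deduplicate-! _≟_ _) values⊆ ⟩
    length (map valueOf (vectorsOver (allFin n) m))  ≡⟨ length-map valueOf (vectorsOver (allFin n) m) ⟩
    length (vectorsOver (allFin n) m)                ≡⟨ length-vectorsOver (allFin n) m ⟩
    length (allFin n) ^ m                            ≡⟨ cong (_^ m) (length-tabulate _) ⟩
    n ^ m                                            ∎
    where
    open ℕP.≤-Reasoning
    _≟_ : DecidableEquality (Subset n)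
    _≟_ = ≡-dec Bool._≟_
    valueOf : Vec (Fin n) m → Subset n
    valueOf w = cutValue A (vertexSet w)
    values⊆ : deduplicate _≟_ (map (cutValue A) (allSubsets n)) ⊆ₗ map valueOf (vectorsOver (allFin n) m)
    values⊆ S∈
      with X , _ , refl ← ∈-map⁻ (cutValue A) (∈-deduplicate⁻ _≟_ _ S∈)
      with w , eq ← rep X
      = subst (_∈ₗ map valueOf (vectorsOver (allFin n) m)) (sym eq) (∈-map⁺ valueOf (∈-vectorsOver w ∈-allFin))

  -- b is the witness when X ∩ A is empty.
  represented-byPicks : ∀ {A b m} (pick : Fin n → List (Fin n) → Vec (Fin n) m) → b ∉ A →
    (∀ c cs → VecAll.All (_∈ₗ c ∷ cs) (pick c cs)) →
    (∀ {c cs x v} → All.All (_∈ A) (c ∷ cs) → x ∈ₗ c ∷ cs → v ∉ A → E x v ≡ true →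
       ∃[ y ] y ∈ᵥ pick c cs × E y v ≡ true) →
    Represented A m
  represented-byPicks {A} {b} {m} pick b∉A pick⊆ dominate X with elements (X ∩ A) in eq
  ... | [] = tabulate (λ _ → b) ,
        cutValue-vertexSet {m = m} {w = tabulate (λ _ → b)} (tabulate⁺ (λ _ b∈A → ⊥-elim (b∉A b∈A)))
          (λ x∈X x∈A _ _ → case subst (_ ∈ₗ_) eq (∈-elements⁺ (x∈p∩q⁺ (x∈X , x∈A))) of λ ())
  ... | c ∷ cs = pick c cs , cutValue-vertexSet (VecAll.map (λ y∈ _ → proj₁ (∈X∩A y∈)) (pick⊆ c cs)) cover
    where
    ∈X∩A : ∀ {y} → y ∈ₗ c ∷ cs → y ∈ X × y ∈ A
    ∈X∩A y∈ = x∈p∩q⁻ X A (∈-elements⁻ (subst (_ ∈ₗ_) (sym eq) y∈))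
    cover : ∀ {x v} → x ∈ X → x ∈ A → v ∉ A → E x v ≡ true → ∃[ y ] y ∈ᵥ pick c cs × y ∈ A × E y v ≡ true
    cover x∈X x∈A v∉A Exv
      with y , y∈pick , Eyv ← dominate (All.tabulate (λ y∈ → proj₂ (∈X∩A y∈)))
                                       (subst (_ ∈ₗ_) eq (∈-elements⁺ (x∈p∩q⁺ (x∈X , x∈A)))) v∉A Exv
      = y , y∈pick , proj₂ (∈X∩A (VecAll.lookup (pick⊆ c cs) y∈pick)) , Eyv

  represented-⁅⁆ : ∀ {u b m} → b ≢ u → Represented ⁅ u ⁆ (suc m)
  represented-⁅⁆ {u} {m = m} b≢u = represented-byPicks (λ c _ → tabulate (λ _ → c))
    (λ b∈⁅u⁆ → b≢u (x∈⁅y⁆⇒x≡y u b∈⁅u⁆)) (λ c cs → tabulate⁺ (λ _ → here refl)) dominate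
    where
    dominate : ∀ {c cs x v} → All.All (_∈ ⁅ u ⁆) (c ∷ cs) → x ∈ₗ c ∷ cs → v ∉ ⁅ u ⁆ → E x v ≡ true →
               ∃[ y ] y ∈ᵥ tabulate {n = suc m} (λ _ → c) × E y v ≡ true
    dominate {c} {x = x} {v} c∷cs⊆⁅u⁆ x∈ _ Exv =
      c , ∈-tabulate⁺ (λ _ → c) zero , subst (λ y → E y v ≡ true) x≡c Exv
      where
      x≡c : x ≡ c
      x≡c = trans (x∈⁅y⁆⇒x≡y u (All.lookup c∷cs⊆⁅u⁆ x∈)) (sym (x∈⁅y⁆⇒x≡y u (All.head c∷cs⊆⁅u⁆)))

  represented-∁⁅⁆ : ∀ {u m} → Represented (∁ ⁅ u ⁆) (suc m)
  represented-∁⁅⁆ {u} {m} X with FinP.any? (λ x → (x ∈? X ∩ ∁ ⁅ u ⁆) ×-dec (E x u Bool.≟ true))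
  ... | yes (x , x∈X∩A , Exu) = tabulate (λ _ → x) , cutValue-vertexSet {m = suc m} {w = tabulate (λ _ → x)}
        (tabulate⁺ (λ _ _ → proj₁ (x∈p∩q⁻ X _ x∈X∩A)))
        (λ _ _ v∉A _ → x , ∈-tabulate⁺ (λ _ → x) zero , proj₂ (x∈p∩q⁻ X _ x∈X∩A) ,
                        subst (λ v → E x v ≡ true) (sym (x∉∁⁅y⁆⇒x≡y u v∉A)) Exu)
  ... | no ∄ = tabulate (λ _ → u) , cutValue-vertexSet {m = suc m} {w = tabulate (λ _ → u)}
        (tabulate⁺ (λ _ u∈A → ⊥-elim (x∈∁p⇒x∉p u∈A (x∈⁅x⁆ u))))
        (λ {x} x∈X x∈A v∉A Exv →
          ⊥-elim (∄ (x , x∈p∩q⁺ (x∈X , x∈A) , subst (λ v → E x v ≡ true) (x∉∁⁅y⁆⇒x≡y u v∉A) Exv)))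

-- Cuts of a circular-trapezoid graph separating small keys from large keys

module TrapezoidCuts {k n : ℕ} (E : Graph n) (T : Fin n → CircTrap (suc k))
         (E⇔ : ∀ u v → u ≢ v → (E u v ≡ true ⇔ Intersect (T u) (T v))) where

  key : Fin n → ℚ
  key x = normL (T x) zero

  Crosses : Fin n → Fin n → Set
  Crosses x v = Crossing (normL (T x)) (normR (T x)) (normL (T v)) (normR (T v))

  adjacent⇔Crosses : ∀ {x v} → x ≢ v → key x ℚ.≤ key v → (E x v ≡ true ⇔ Crosses x v)
  adjacent⇔Crosses {x} {v} x≢v x≤v = ⇔.trans (E⇔ x v x≢v) (Intersect⇔Crossing (T x) (T v) x≤v)

  adjacent⇔flipCrosses : ∀ {x v} → x ≢ v → key v ℚ.≤ key x → (E x v ≡ true ⇔ Crosses v x)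
  adjacent⇔flipCrosses {x} {v} x≢v v≤x = ⇔.trans (E⇔ x v x≢v)
    (⇔.trans (mk⇔ (Intersect-sym (T x) (T v)) (Intersect-sym (T v) (T x)))
             (Intersect⇔Crossing (T v) (T x) v≤x))

  rightmost leftmost : Fin (suc k) → Fin n → List (Fin n) → Fin n
  rightmost i = argmax (λ y → normR (T y) i)
  leftmost  i = argmin (λ y → normL (T y) i)

  extremal : Fin n → List (Fin n) → Vec (Fin n) (suc k ℕ.+ suc k)
  extremal c cs = tabulate (λ i → rightmost i c cs) Vec.++ tabulate (λ i → leftmost i c cs)

  extremal-⊆ : ∀ c cs → VecAll.All (_∈ₗ c ∷ cs) (extremal c cs)
  extremal-⊆ c cs = All-++⁺ (tabulate⁺ (λ i → selected (argmax-sel (λ y → normR (T y) i) c cs)))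
                            (tabulate⁺ (λ i → selected (argmin-sel (λ y → normL (T y) i) c cs)))
    where
    selected : ∀ {y} → y ≡ c ⊎ y ∈ₗ cs → y ∈ₗ c ∷ cs
    selected (inj₁ refl) = here refl
    selected (inj₂ y∈cs) = there y∈cs

  rightmost∈extremal : ∀ i c cs → rightmost i c cs ∈ᵥ extremal c cs
  rightmost∈extremal i c cs = ∈ᵥ-++⁺ˡ (∈-tabulate⁺ (λ i → rightmost i c cs) i)

  leftmost∈extremal : ∀ i c cs → leftmost i c cs ∈ᵥ extremal c cs
  leftmost∈extremal i c cs =
    ∈ᵥ-++⁺ʳ (tabulate (λ i → rightmost i c cs)) (∈-tabulate⁺ (λ i → leftmost i c cs) i)

  normR≤normR[rightmost] : ∀ {c cs x} i → x ∈ₗ c ∷ cs → normR (T x) i ℚ.≤ normR (T (rightmost i c cs)) i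
  normR≤normR[rightmost] {c} {cs} i (here refl)  = f[⊥]≤f[argmax] {f = λ y → normR (T y) i} c cs
  normR≤normR[rightmost] {c} {cs} i (there x∈cs) =
    All.lookup (f[xs]≤f[argmax] {f = λ y → normR (T y) i} c cs) x∈cs

  normL[leftmost]≤normL : ∀ {c cs x} i → x ∈ₗ c ∷ cs → normL (T (leftmost i c cs)) i ℚ.≤ normL (T x) i
  normL[leftmost]≤normL {c} {cs} i (here refl)  = f[argmin]≤f[⊤] {f = λ y → normL (T y) i} c cs
  normL[leftmost]≤normL {c} {cs} i (there x∈cs) =
    All.lookup (f[argmin]≤f[xs] {f = λ y → normL (T y) i} c cs) x∈cs

  Crosses-extremalˡ : ∀ {c cs x v} → x ∈ₗ c ∷ cs → Crosses x v → ∃[ y ] y ∈ᵥ extremal c cs × Crosses y v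
  Crosses-extremalˡ {c} {cs} x∈ (inj₁ (i , Lv≤Rx)) =
    rightmost i c cs , rightmost∈extremal i c cs , inj₁ (i , ℚP.≤-trans Lv≤Rx (normR≤normR[rightmost] i x∈))
  Crosses-extremalˡ {c} {cs} x∈ (inj₂ (j , Lx+1≤Rv)) =
    leftmost j c cs , leftmost∈extremal j c cs ,
    inj₂ (j , ℚP.≤-trans (ℚP.+-monoˡ-≤ 1ℚ (normL[leftmost]≤normL j x∈)) Lx+1≤Rv)

  Crosses-extremalʳ : ∀ {c cs x v} → x ∈ₗ c ∷ cs → Crosses v x → ∃[ y ] y ∈ᵥ extremal c cs × Crosses v y
  Crosses-extremalʳ {c} {cs} x∈ (inj₁ (i , Lx≤Rv)) =
    leftmost i c cs , leftmost∈extremal i c cs , inj₁ (i , ℚP.≤-trans (normL[leftmost]≤normL i x∈) Lx≤Rv)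
  Crosses-extremalʳ {c} {cs} x∈ (inj₂ (j , Lv+1≤Rx)) =
    rightmost j c cs , rightmost∈extremal j c cs , inj₂ (j , ℚP.≤-trans Lv+1≤Rx (normR≤normR[rightmost] j x∈))

  represented-crossing : ∀ {A b} (Cross : Fin n → Fin n → Set) → b ∉ A →
    (∀ {x v} → x ∈ A → v ∉ A → (E x v ≡ true ⇔ Cross x v)) →
    (∀ {c cs x v} → x ∈ₗ c ∷ cs → Cross x v → ∃[ y ] y ∈ᵥ extremal c cs × Cross y v) →
    Represented E A (suc k ℕ.+ suc k)
  represented-crossing {A} Cross b∉A E⇔Cross extremal-dominates =
    represented-byPicks E extremal b∉A extremal-⊆ dominate
    where
    dominate : ∀ {c cs x v} → All.All (_∈ A) (c ∷ cs) → x ∈ₗ c ∷ cs → v ∉ A → E x v ≡ true →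
               ∃[ y ] y ∈ᵥ extremal c cs × E y v ≡ true
    dominate {c} {cs} c∷cs⊆A x∈ v∉A Exv
      with y , y∈ , y-v ← extremal-dominates x∈ (Equivalence.to (E⇔Cross (All.lookup c∷cs⊆A x∈) v∉A) Exv)
      = y , y∈ , Equivalence.from (E⇔Cross (All.lookup c∷cs⊆A (VecAll.lookup (extremal-⊆ c cs) y∈)) v∉A) y-v

  represented-below : ∀ {A b} → b ∉ A → (∀ {x v} → x ∈ A → v ∉ A → key x ℚ.≤ key v) →
    Represented E A (suc k ℕ.+ suc k)
  represented-below b∉A below = represented-crossing Crosses b∉A
    (λ x∈A v∉A → adjacent⇔Crosses (∈∉⇒≢ x∈A v∉A) (below x∈A v∉A)) Crosses-extremalˡ

  represented-above : ∀ {A b} → b ∉ A → (∀ {x v} → x ∈ A → v ∉ A → key v ℚ.≤ key x) →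
    Represented E A (suc k ℕ.+ suc k)
  represented-above b∉A above = represented-crossing (λ x v → Crosses v x) b∉A
    (λ x∈A v∉A → adjacent⇔flipCrosses (∈∉⇒≢ x∈A v∉A) (above x∈A v∉A)) Crosses-extremalʳ

-- Caterpillar decompositions

caterpillar : ∀ {n} → Fin n → List (Fin n) → BTree n
caterpillar v []       = leaf v
caterpillar v (w ∷ ws) = node (leaf v) (caterpillar w ws)

leaves-caterpillar : ∀ {n} (v : Fin n) vs → leaves (caterpillar v vs) ≡ v ∷ vs
leaves-caterpillar v []       = refl
leaves-caterpillar v (w ∷ ws) = cong (v ∷_) (leaves-caterpillar w ws)

∈-leafSet⁺ : ∀ {n} (t : BTree n) {x} → x ∈ₗ leaves t → x ∈ leafSet t
∈-leafSet⁺ (leaf v)   (here refl) = x∈⁅x⁆ v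
∈-leafSet⁺ (node s t) x∈ with ∈-++⁻ (leaves s) x∈
... | inj₁ x∈s = x∈p∪q⁺ (inj₁ (∈-leafSet⁺ s x∈s))
... | inj₂ x∈t = x∈p∪q⁺ (inj₂ (∈-leafSet⁺ t x∈t))

∈-leafSet⁻ : ∀ {n} (t : BTree n) {x} → x ∈ leafSet t → x ∈ₗ leaves t
∈-leafSet⁻ (leaf v)   x∈ = here (x∈⁅y⁆⇒x≡y v x∈)
∈-leafSet⁻ (node s t) x∈ with x∈p∪q⁻ (leafSet s) (leafSet t) x∈
... | inj₁ x∈s = ∈-++⁺ˡ (∈-leafSet⁻ s x∈s)
... | inj₂ x∈t = ∈-++⁺ʳ (leaves s) (∈-leafSet⁻ t x∈t)

subtree-caterpillar : ∀ {n} {s} (v : Fin n) vs → Subtree s (caterpillar v vs) →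
  (∃[ u ] u ∈ₗ v ∷ vs × s ≡ leaf u) ⊎ (∃[ pre ] ∃[ w ] ∃[ ws ] v ∷ vs ≡ pre ++ w ∷ ws × s ≡ caterpillar w ws)
subtree-caterpillar v []       here        = inj₁ (v , here refl , refl)
subtree-caterpillar v (w ∷ ws) here        = inj₂ ([] , v , w ∷ ws , refl , refl)
subtree-caterpillar v (w ∷ ws) (left here) = inj₁ (v , here refl , refl)
subtree-caterpillar v (w ∷ ws) (right p) with subtree-caterpillar w ws p
... | inj₁ (u , u∈ , refl)                  = inj₁ (u , there u∈ , refl)
... | inj₂ (pre , w′ , ws′ , split , refl) = inj₂ (v ∷ pre , w′ , ws′ , cong (v ∷_) split , refl)

properSubtree-caterpillar : ∀ {n} {s} (v : Fin n) vs → ProperSubtree s (caterpillar v vs) →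
  (∃[ u ] u ∈ₗ v ∷ vs × s ≡ leaf u) ⊎ (∃[ pre ] ∃[ w ] ∃[ ws ] vs ≡ pre ++ w ∷ ws × s ≡ caterpillar w ws)
properSubtree-caterpillar v (w ∷ ws) (left here) = inj₁ (v , here refl , refl)
properSubtree-caterpillar v (w ∷ ws) (right p) with subtree-caterpillar w ws p
... | inj₁ (u , u∈ , refl)                  = inj₁ (u , there u∈ , refl)
... | inj₂ (pre , w′ , ws′ , split , refl) = inj₂ (pre , w′ , ws′ , split , refl)

AllPairs-++⇒ : ∀ {a r} {A : Set a} {R : A → A → Set r} {xs ys : List A} →
  AllPairs R (xs ++ ys) → ∀ {x y} → x ∈ₗ xs → y ∈ₗ ys → R x y
AllPairs-++⇒ {xs = _ ∷ xs} (Rx ∷ _) (here refl) y∈ys = All.lookup Rx (∈-++⁺ʳ xs y∈ys)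
AllPairs-++⇒ {xs = _ ∷ xs} (_ ∷ R) (there x∈xs) y∈ys = AllPairs-++⇒ R x∈xs y∈ys

another : ∀ {m} → Fin (suc (suc m)) → Fin (suc (suc m))
another zero    = suc zero
another (suc _) = zero

another≢ : ∀ {m} (u : Fin (suc (suc m))) → another u ≢ u
another≢ zero    ()
another≢ (suc _) ()

module CaterpillarDecomposition {k m : ℕ} (E : Graph (suc (suc m)))
         (T : Fin (suc (suc m)) → CircTrap (suc k))
         (E⇔ : ∀ u v → u ≢ v → (E u v ≡ true ⇔ Intersect (T u) (T v))) where

  open TrapezoidCuts E T E⇔

  width : ℕ
  width = suc (suc m) ^ (suc k ℕ.+ suc k)

  BothSidesBounded : Subset (suc (suc m)) → Set
  BothSidesBounded A = cutBoolCount E A ≤ width × cutBoolCount E (∁ A) ≤ width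

  _≤ₖ_ : Fin (suc (suc m)) → Fin (suc (suc m)) → Set
  x ≤ₖ y = key x ℚ.≤ key y

  leaf-cut : ∀ u → BothSidesBounded ⁅ u ⁆
  leaf-cut u = cutBoolCount≤ E (represented-⁅⁆ E {m = k ℕ.+ suc k} (another≢ u)) ,
               cutBoolCount≤ E (represented-∁⁅⁆ E {m = k ℕ.+ suc k})

  suffix-cut : ∀ p pre w ws → Unique (p ∷ pre ++ w ∷ ws) → (∀ x → x ∈ₗ p ∷ pre ++ w ∷ ws) →
    AllPairs _≤ₖ_ (p ∷ pre ++ w ∷ ws) → BothSidesBounded (leafSet (caterpillar w ws))
  suffix-cut p pre w ws unique complete sorted =
    cutBoolCount≤ E (represented-above p∉A above) , cutBoolCount≤ E (represented-below w∉∁A below)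
    where
    A : Subset (suc (suc m))
    A = leafSet (caterpillar w ws)
    ∈A⁺ : ∀ {x} → x ∈ₗ w ∷ ws → x ∈ A
    ∈A⁺ x∈ = ∈-leafSet⁺ (caterpillar w ws) (subst (_ ∈ₗ_) (sym (leaves-caterpillar w ws)) x∈)
    ∈A⁻ : ∀ {x} → x ∈ A → x ∈ₗ w ∷ ws
    ∈A⁻ x∈A = subst (_ ∈ₗ_) (leaves-caterpillar w ws) (∈-leafSet⁻ (caterpillar w ws) x∈A)
    ∉A⇒∈prefix : ∀ {v} → v ∉ A → v ∈ₗ p ∷ pre
    ∉A⇒∈prefix {v} v∉A with ∈-++⁻ (p ∷ pre) (complete v)
    ... | inj₁ v∈prefix = v∈prefix
    ... | inj₂ v∈suffix = ⊥-elim (v∉A (∈A⁺ v∈suffix))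
    above : ∀ {x v} → x ∈ A → v ∉ A → key v ℚ.≤ key x
    above x∈A v∉A = AllPairs-++⇒ {xs = p ∷ pre} sorted (∉A⇒∈prefix v∉A) (∈A⁻ x∈A)
    below : ∀ {x v} → x ∈ ∁ A → v ∉ ∁ A → key x ℚ.≤ key v
    below x∈∁A v∉∁A = above (x∉∁p⇒x∈p v∉∁A) (x∈∁p⇒x∉p x∈∁A)
    p∉A : p ∉ A
    p∉A p∈A = AllPairs-++⇒ {xs = p ∷ pre} unique (here refl) (∈A⁻ p∈A) refl
    w∉∁A : w ∉ ∁ A
    w∉∁A = x∈p⇒x∉∁p (∈A⁺ (here refl))

  caterpillar-bounded : ∀ xs → Unique xs → (∀ x → x ∈ₗ xs) → AllPairs _≤ₖ_ xs → BoolwLog2AtMost E width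
  caterpillar-bounded []       _      complete _      = case complete zero of λ ()
  caterpillar-bounded (v ∷ vs) unique complete sorted =
    caterpillar v vs ,
    (subst Unique (sym (leaves-caterpillar v vs)) unique ,
     (λ x → subst (x ∈ₗ_) (sym (leaves-caterpillar v vs)) (complete x))) ,
    cuts
    where
    cuts : ∀ s → ProperSubtree s (caterpillar v vs) → BothSidesBounded (leafSet s)
    cuts s s⊂ with properSubtree-caterpillar v vs s⊂
    ... | inj₁ (u , _ , refl)               = leaf-cut u
    ... | inj₂ (pre , w , ws , refl , refl) = suffix-cut v pre w ws unique complete sorted

  -- The equivalence of this order is equality of keys, so ties need no antisymmetry on vertices.
  keyOrder : DecTotalOrder _ _ _
  keyOrder = On.decTotalOrder ℚP.≤-decTotalOrder key

  open Sort keyOrder using (sort; sort-↭; sort-↗)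

  boolw≤ : BoolwLog2AtMost E width
  boolw≤ = caterpillar-bounded (sort (allFin _))
    (PermutationSetoid.Unique-resp-↭ (setoid _) (↭⇒↭ₛ (↭-sym (sort-↭ (allFin _)))) (allFin⁺ _))
    (λ x → ∈-resp-↭ (↭-sym (sort-↭ (allFin _))) (∈-allFin x))
    (Sorted⇒AllPairs (DecTotalOrder.totalOrder keyOrder) (sort-↗ (allFin _)))

boolw-singleVertex : ∀ (E : Graph 1) b → BoolwLog2AtMost E b
boolw-singleVertex E b = leaf zero , (All.[] ∷ AllPairs.[] , λ { zero → here refl }) , λ _ ()

mainTheorem5 : (k n : ℕ) → 1 ≤ k → 1 ≤ n → (E : Graph n) →
    IsCircularTrapezoidGraph k E → BoolwLog2AtMost E (n ^ (2 * k))
mainTheorem5 (suc k) 1             _ _ E _             = boolw-singleVertex E _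
mainTheorem5 (suc k) (suc (suc m)) _ _ E (_ , T , E⇔) =
  subst (λ e → BoolwLog2AtMost E (suc (suc m) ^ (suc k ℕ.+ e))) (sym (ℕP.+-identityʳ (suc k)))
    (CaterpillarDecomposition.boolw≤ E T E⇔)
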